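{- Let $n\ge 3$ and consider the digraph $\overrightarrow{K_n}$ on vertices $v_1,\dots,v_n$ with the arc labeling $f(\overrightarrow{(v_i,v_j)}) = (i-1)n-\binom{i}{2}+j-i$ for $1\le i<j\le n$. For each $i$, let $S^-_{v_i}=\sum_{p=1}^{i-1} f(\overrightarrow{(v_p,v_i)})$ be the sum of the labels of the arcs entering $v_i$. Then $S^-_{v_i}<S^-_{v_j}$ whenever $1\le i<j\le n$.
   Context: $\overrightarrow{K_n}$ is the directed graph with vertex set $\{v_1,\dots,v_n\}$ having, for every pair $1\le i<j\le n$, exactly one arc, directed from $v_i$ to $v_j$. The map $(i,j)\mapsto (i-1)n-\binom{i}{2}+j-i$ is a bijection from $\{(i,j):1\le i<j\le n\}$ onto $\{1,\dots,\binom n2\}$. -}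

module Defs where

open import Data.Nat using (ℕ; zero; suc; _+_; _*_; _∸_)
open import Data.Nat.Combinatorics using (_C_)

-- Label of the arc (v_i, v_j) of the transitive tournament K_n (1 ≤ i < j ≤ n):
--   f(v_i,v_j) = (i-1)n - C(i,2) + j - i.
-- For 1 ≤ i < j ≤ n this quantity is ≥ 1, so computing it as
-- ((i-1)n + j) ∸ (C(i,2) + i) agrees with the integer formula.
arcLabel : ℕ → ℕ → ℕ → ℕ
arcLabel n i j = ((i ∸ 1) * n + j) ∸ (i C 2 + i)

sumFrom1 : ℕ → (ℕ → ℕ) → ℕ
sumFrom1 zero    g = 0
sumFrom1 (suc m) g = sumFrom1 m g + g (suc m)

inSum : ℕ → ℕ → ℕ
inSum n i = sumFrom1 (i ∸ 1) (λ p → arcLabel n p i)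

-- The in-sum grows from v_i to v_{i+1}: each arc (v_p, v_i) is matched by the arc
-- (v_p, v_{i+1}), whose label is one larger, and v_{i+1} receives the additional arc
-- (v_i, v_{i+1}), whose label is positive.
module Submission where

open import Defs
open import Data.Nat using (ℕ; _≤_; _<_; zero; suc; _+_; _*_; _∸_; s≤s; z≤n)
open import Data.Nat.Properties
open import Data.Nat.Combinatorics using (_C_; nC1≡n; nCk+nC[k+1]≡[n+1]C[k+1])
open import Data.Sum using (inj₁; inj₂)
open import Relation.Binary.PropositionalEquality using (_≡_; refl; sym; cong)

nC2≤[n∸1]*n : ∀ n → n C 2 ≤ (n ∸ 1) * n
nC2≤[n∸1]*n zero    = z≤n
nC2≤[n∸1]*n (suc n) = begin
  suc n C 2         ≡⟨ sym (nCk+nC[k+1]≡[n+1]C[k+1] n 1) ⟩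
  n C 1 + n C 2     ≡⟨ cong (_+ n C 2) (nC1≡n n) ⟩
  n + n C 2         ≤⟨ +-monoʳ-≤ n (nC2≤[n∸1]*n n) ⟩
  n + (n ∸ 1) * n   ≡⟨ n+[n∸1]*n≡n*n n ⟩
  n * n             ≤⟨ *-monoʳ-≤ n (n≤1+n n) ⟩
  n * suc n         ∎
  where
  open ≤-Reasoning
  n+[n∸1]*n≡n*n : ∀ n → n + (n ∸ 1) * n ≡ n * n
  n+[n∸1]*n≡n*n zero    = refl
  n+[n∸1]*n≡n*n (suc n) = refl

arcLabel-monoʳ-≤ : ∀ n i {j j′} → j ≤ j′ → arcLabel n i j ≤ arcLabel n i j′
arcLabel-monoʳ-≤ n i j≤j′ = ∸-monoˡ-≤ (i C 2 + i) (+-monoʳ-≤ ((i ∸ 1) * n) j≤j′)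

arcLabel-positive : ∀ {n i j} → i < j → j ≤ n → 0 < arcLabel n i j
arcLabel-positive {n} {i} {j} i<j j≤n = m<n⇒0<n∸m (+-mono-≤-< iC2≤[i∸1]*n i<j)
  where
  iC2≤[i∸1]*n : i C 2 ≤ (i ∸ 1) * n
  iC2≤[i∸1]*n = ≤-trans (nC2≤[n∸1]*n i) (*-monoʳ-≤ (i ∸ 1) (≤-trans (<⇒≤ i<j) j≤n))

sumFrom1-mono-≤ : ∀ m {g h : ℕ → ℕ} → (∀ p → g p ≤ h p) → sumFrom1 m g ≤ sumFrom1 m h
sumFrom1-mono-≤ zero    g≤h = z≤n
sumFrom1-mono-≤ (suc m) g≤h = +-mono-≤ (sumFrom1-mono-≤ m g≤h) (g≤h (suc m))

inSum-<-suc : ∀ {n} i → suc (suc i) ≤ n → inSum n (suc i) < inSum n (suc (suc i))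
inSum-<-suc {n} i i+2≤n = begin-strict
  inSum n (suc i)                 ≡⟨ +-identityʳ _ ⟨
  inSum n (suc i) + 0             <⟨ +-mono-≤-< enteringArcs newArc ⟩
  sumFrom1 i (λ p → arcLabel n p (suc (suc i))) + arcLabel n (suc i) (suc (suc i))
                                  ≡⟨⟩
  inSum n (suc (suc i))           ∎
  where
  open ≤-Reasoning
  enteringArcs : inSum n (suc i) ≤ sumFrom1 i (λ p → arcLabel n p (suc (suc i)))
  enteringArcs = sumFrom1-mono-≤ i (λ p → arcLabel-monoʳ-≤ n p (n≤1+n (suc i)))
  newArc : 0 < arcLabel n (suc i) (suc (suc i))
  newArc = arcLabel-positive ≤-refl i+2≤n

<-mono-on-interval : (g : ℕ → ℕ) {a b : ℕ} →
  (∀ {k} → a ≤ k → suc k ≤ b → g k < g (suc k)) →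
  ∀ {i j} → a ≤ i → i < j → j ≤ b → g i < g j
<-mono-on-interval g step {j = suc j} a≤i (s≤s i≤j) j+1≤b with m≤n⇒m<n∨m≡n i≤j
... | inj₂ refl = step a≤i j+1≤b
... | inj₁ i<j  = <-trans (<-mono-on-interval g step a≤i i<j (<⇒≤ j+1≤b))
                          (step (≤-trans a≤i i≤j) j+1≤b)

proposition1 : (n : ℕ) → 3 ≤ n → (i j : ℕ) → 1 ≤ i → i < j → j ≤ n →
    inSum n i < inSum n j
proposition1 n _ i j = <-mono-on-interval (inSum n) step
  where
  step : ∀ {k} → 1 ≤ k → suc k ≤ n → inSum n k < inSum n (suc k)
  step {suc k} _ = inSum-<-suc k
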